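{- For all integers $n,q\ge 2$, $f\big(q,\,2+(q-1)(n-1)\big)>n^{q-1}$.
   Context: $D_N$ is the complete digraph on $N$ vertices (two oppositely directed edges between each pair of distinct vertices, no loops). A walk of length $m$ is a sequence of $m$ vertices $v_1,\dots,v_m$ (repetitions allowed) with each $\overrightarrow{v_iv_{i+1}}$ an edge; it is monochromatic if all its edges have the same color. $f(q,m)$ is the smallest $N$ such that every $q$-coloring of the edges of $D_N$ contains a monochromatic walk of length $m$. -}

module Defs where

open import Data.Nat using (ℕ; zero; suc; _<_; _≤_)
open import Data.Nat.Properties using (≤-trans; n≤1+n)
open import Data.Fin using (Fin; fromℕ<)
open import Data.Product using (Σ; ∃; _×_)
open import Relation.Binary.PropositionalEquality using (_≡_; _≢_)

-- A q-colouring of the edges of the complete digraph D_N on vertex set Fin N.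
-- col u v is the colour of the directed edge u → v; the value at u ≡ v
-- (not an edge, D_N has no loops) is irrelevant and never consulted.
Coloring : ℕ → ℕ → Set
Coloring q N = Fin N → Fin N → Fin q

-- index helpers: for suc i < m, positions i and i+1 of a length-m sequence
idx : ∀ {m} i → suc i < m → Fin m
idx {m} i h = fromℕ< (≤-trans (n≤1+n (suc i)) h)

idx⁺ : ∀ {m} i → suc i < m → Fin m
idx⁺ i h = fromℕ< h

-- A walk of length m in D_N: a sequence of m vertices v_1,…,v_m such that
-- each v_i → v_{i+1} is an edge of D_N, i.e. v_i ≢ v_{i+1}.
IsWalk : ∀ {N} m → (Fin m → Fin N) → Set
IsWalk m w = ∀ i (h : suc i < m) → w (idx i h) ≢ w (idx⁺ i h)

IsMonoOf : ∀ {q N} m → Coloring q N → (Fin m → Fin N) → Fin q → Set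
IsMonoOf m col w c = ∀ i (h : suc i < m) → col (w (idx i h)) (w (idx⁺ i h)) ≡ c

HasMonoWalk : ∀ {q N} m → Coloring q N → Set
HasMonoWalk m col = Σ (Fin _ → Fin _) λ w → IsWalk m w × ∃ λ c → IsMonoOf m col w c

Arrows : ℕ → ℕ → ℕ → Set
Arrows q m N = (col : Coloring q N) → HasMonoWalk m col

module Submission where

open import Defs
open import Data.Nat using (ℕ; _≤_; _+_; _*_; _∸_; _^_)
open import Relation.Nullary using (¬_)

open import Data.Nat using (zero; suc; _<_; z≤n; s≤s; _<?_)
open import Data.Nat.Properties
open import Data.Nat.DivMod using (_/_; _%_; m%n<n; m≡m%n+[m/n]*n; m<n*o⇒m/o<n)
open import Data.Fin as Fin using (Fin; toℕ; fromℕ<)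
open import Data.Fin.Properties using (toℕ<n; toℕ-injective)
open import Data.Vec using (Vec; []; _∷_; lookup; sum; head; tail)
open import Data.Vec.Relation.Unary.All using (All; []; _∷_)
open import Data.Vec.Relation.Unary.All.Properties using (lookup⁺)
open import Data.Vec.Relation.Binary.Pointwise.Inductive using (Pointwise; []; _∷_)
open import Data.Product using (Σ; _,_)
open import Data.Sum using (_⊎_; inj₁; inj₂)
open import Data.Empty using (⊥-elim)
open import Function using (_∘_)
open import Relation.Nullary using (yes; no)
open import Relation.Binary.PropositionalEquality
  using (_≡_; _≢_; refl; sym; cong; cong₂; subst; module ≡-Reasoning)

-- 1. Potential lemma: if every colour c carries a potential on the vertices
--    that is bounded by B and drops strictly along each c-coloured edge, then
--    a monochromatic walk has at most B edges.
-- 2. Encode the vertices injectively as vectors of k base-n digits in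
--    {0,…,p}.  Colour the edge a → b by (i+1) for the first coordinate i with
--    a_i < b_i, and by 0 if there is none; then b ≤ a pointwise and b ≠ a.
--    The potentials are p - a_i for colour i+1 and the digit sum for colour 0;
--    all are bounded by k·p, so step 1 rules out walks of length 2 + k·p.

-- Step 1: a potential bounded by B which strictly decreases along every edge
-- of its colour forbids monochromatic walks of length 2 + B (they have B + 1
-- edges, hence B + 2 distinct potential values in {0,…,B}).
no-long-monochromatic-walk :
  ∀ {q N} (col : Coloring q N) (pot : Fin q → Fin N → ℕ) (B : ℕ) →
  (∀ u v → u ≢ v → pot (col u v) v < pot (col u v) u) →
  (∀ c v → pot c v ≤ B) →
  ¬ HasMonoWalk (2 + B) col
no-long-monochromatic-walk col pot B decreases bounded (w , walk , c , mono) =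
  <-irrefl refl (≤-trans (m≤n+m (suc B) _) (descent (suc B) ≤-refl))
  where
    descent : ∀ i (h : i < 2 + B) → pot c (w (fromℕ< h)) + i ≤ B
    descent zero h = ≤-trans (≤-reflexive (+-identityʳ _)) (bounded c _)
    descent (suc i) h = begin
      pot c (w (idx⁺ i h)) + suc i   ≡⟨ +-suc _ i ⟩
      suc (pot c (w (idx⁺ i h)) + i) ≤⟨ +-monoˡ-≤ i step ⟩
      pot c (w (idx i h)) + i        ≤⟨ descent i (≤-trans (n≤1+n (suc i)) h) ⟩
      B                              ∎
      where
        open ≤-Reasoning
        step : pot c (w (idx⁺ i h)) < pot c (w (idx i h))
        step = subst (λ d → pot d (w (idx⁺ i h)) < pot d (w (idx i h)))
                     (mono i h) (decreases _ _ (walk i h))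

sum-mono : ∀ {k} {xs ys : Vec ℕ k} → Pointwise _≤_ xs ys → sum xs ≤ sum ys
sum-mono [] = z≤n
sum-mono (x≤y ∷ xs≤ys) = +-mono-≤ x≤y (sum-mono xs≤ys)

sum-strict : ∀ {k} {xs ys : Vec ℕ k} → Pointwise _≤_ xs ys → xs ≢ ys → sum xs < sum ys
sum-strict [] xs≢ys = ⊥-elim (xs≢ys refl)
sum-strict {xs = x ∷ xs} (x≤y ∷ xs≤ys) x∷xs≢y∷ys with m≤n⇒m<n∨m≡n x≤y
... | inj₁ x<y  = +-mono-<-≤ x<y (sum-mono xs≤ys)
... | inj₂ refl = +-monoʳ-< x (sum-strict xs≤ys (x∷xs≢y∷ys ∘ cong (x ∷_)))

increase-or-dominated : ∀ {k} (a b : Vec ℕ k) →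
  Σ (Fin k) (λ i → lookup a i < lookup b i) ⊎ Pointwise _≤_ b a
increase-or-dominated [] [] = inj₂ []
increase-or-dominated (x ∷ a) (y ∷ b) with x <? y
... | yes x<y = inj₁ (Fin.zero , x<y)
... | no x≮y with increase-or-dominated a b
...   | inj₁ (i , increase) = inj₁ (Fin.suc i , increase)
...   | inj₂ dominated = inj₂ (≮⇒≥ x≮y ∷ dominated)

module DigitVectors (p : ℕ) where

  colour : ∀ {k} → Vec ℕ k → Vec ℕ k → Fin (suc k)
  colour a b with increase-or-dominated a b
  ... | inj₁ (i , _) = Fin.suc i
  ... | inj₂ _ = Fin.zero

  potential : ∀ {k} → Fin (suc k) → Vec ℕ k → ℕ
  potential Fin.zero a = sum a
  potential (Fin.suc i) a = p ∸ lookup a i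

  potential-decreases : ∀ {k} (a b : Vec ℕ k) → All (_≤ p) b → a ≢ b →
    potential (colour a b) b < potential (colour a b) a
  potential-decreases a b b≤p a≢b with increase-or-dominated a b
  ... | inj₁ (i , increase) = ∸-monoʳ-< increase (lookup⁺ b≤p i)
  ... | inj₂ dominated = sum-strict dominated (a≢b ∘ sym)

  potential-bounded : ∀ {k} (c : Fin (suc k)) (a : Vec ℕ k) → All (_≤ p) a →
    potential c a ≤ k * p
  potential-bounded Fin.zero a a≤p = sum-bounded a≤p
    where
      sum-bounded : ∀ {k} {xs : Vec ℕ k} → All (_≤ p) xs → sum xs ≤ k * p
      sum-bounded [] = z≤n
      sum-bounded (x≤p ∷ xs≤p) = +-mono-≤ x≤p (sum-bounded xs≤p)
  potential-bounded {suc k} (Fin.suc i) a a≤p =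
    ≤-trans (m∸n≤m p (lookup a i)) (m≤m+n p (k * p))

  digits : (k : ℕ) → ℕ → Vec ℕ k
  digits zero x = []
  digits (suc k) x = x % suc p ∷ digits k (x / suc p)

  digits-bounded : ∀ k x → All (_≤ p) (digits k x)
  digits-bounded zero x = []
  digits-bounded (suc k) x = ≤-pred (m%n<n x (suc p)) ∷ digits-bounded k (x / suc p)

  digits-injective : ∀ k {x y} → x < suc p ^ k → y < suc p ^ k →
    digits k x ≡ digits k y → x ≡ y
  digits-injective zero {zero} {zero} _ _ _ = refl
  digits-injective zero {suc _} (s≤s ()) _ _
  digits-injective zero {zero} {suc _} _ (s≤s ()) _
  digits-injective (suc k) {x} {y} x< y< same = begin
    x                                ≡⟨ m≡m%n+[m/n]*n x (suc p) ⟩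
    x % suc p + (x / suc p) * suc p  ≡⟨ cong₂ (λ d r → d + r * suc p)
                                              (cong head same) quotients ⟩
    y % suc p + (y / suc p) * suc p  ≡⟨ sym (m≡m%n+[m/n]*n y (suc p)) ⟩
    y                                ∎
    where
      open ≡-Reasoning
      quotient< : ∀ {z} → z < suc p ^ suc k → z / suc p < suc p ^ k
      quotient< {z} z< = m<n*o⇒m/o<n (subst (z <_) (*-comm (suc p) (suc p ^ k)) z<)
      quotients : x / suc p ≡ y / suc p
      quotients = digits-injective k (quotient< x<) (quotient< y<) (cong tail same)

lemma1 : (n q : ℕ) → 2 ≤ n → 2 ≤ q →
    (N : ℕ) → N ≤ n ^ (q ∸ 1) → ¬ Arrows q (2 + (q ∸ 1) * (n ∸ 1)) N
lemma1 (suc p) (suc k) _ _ N N≤n^k arrows =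
  no-long-monochromatic-walk col pot (k * p) decreases bounded (arrows col)
  where
    open DigitVectors p

    code : Fin N → Vec ℕ k
    code u = digits k (toℕ u)

    code-injective : ∀ {u v} → code u ≡ code v → u ≡ v
    code-injective {u} {v} = toℕ-injective ∘ digits-injective k
      (≤-trans (toℕ<n u) N≤n^k) (≤-trans (toℕ<n v) N≤n^k)

    col : Coloring (suc k) N
    col u v = colour (code u) (code v)

    pot : Fin (suc k) → Fin N → ℕ
    pot c u = potential c (code u)

    decreases : ∀ u v → u ≢ v → pot (col u v) v < pot (col u v) u
    decreases u v u≢v = potential-decreases (code u) (code v)
      (digits-bounded k (toℕ v)) (u≢v ∘ code-injective)

    bounded : ∀ c v → pot c v ≤ k * p
    bounded c v = potential-bounded c (code v) (digits-bounded k (toℕ v))
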